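{- Let $G$ be a strongly connected ribbon digraph. Linear equivalence of divisor-and-rotor configurations on $G$ is an equivalence relation.
   Context: A digraph here is strongly connected, may have multiple edges, and has no loops. A ribbon digraph is a digraph with, for each vertex $v$, a fixed cyclic ordering of the edges leaving $v$; $e^+$ denotes the edge after $e$ in this order. A divisor is $x\in\mathbb{Z}^{V(G)}$. A rotor configuration $\varrho$ assigns to each vertex $v$ an edge $\varrho(v)$ with tail $v$. A divisor-and-rotor configuration (DRC) is a pair $(x,\varrho)$. Routing at $v$ transforms $(x,\varrho)$ into $(x',\varrho')$ with $\varrho'(v)=\varrho(v)^+$, $\varrho'(u)=\varrho(u)$ for $u\ne v$, and $x'=x-\mathbf{1}_v+\mathbf{1}_{v'}$ where $v'$ is the head of $\varrho(v)^+$. An unconstrained routing is a routing performed with no condition on $x(v)$. Two DRCs $(x_1,\varrho_1)$, $(x_2,\varrho_2)$ are linearly equivalent, $(x_1,\varrho_1)\sim(x_2,\varrho_2)$, if $(x_2,\varrho_2)$ can be reached from $(x_1,\varrho_1)$ by a (finite, possibly empty) sequence of unconstrained routings. -}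

module Defs where

open import Data.Nat using (ℕ; suc)
open import Data.Fin using (Fin)
open import Data.Integer using (ℤ; _+_; _-_; +_)
open import Data.Vec using (Vec; lookup; _[_]%=_; _[_]≔_)
open import Data.Product using (Σ; ∃; _×_; _,_; proj₁)
open import Function using (_∘_)
open import Relation.Binary.PropositionalEquality using (_≡_; _≢_)
open import Relation.Binary.Construct.Closure.ReflexiveTransitive using (Star)

iter : ∀ {A : Set} → (A → A) → ℕ → A → A
iter f ℕ.zero a = a
iter f (suc k) a = f (iter f k a)

record Digraph (n m : ℕ) : Set where
  field
    tail : Fin m → Fin n
    head : Fin m → Fin n

module _ {n m : ℕ} (G : Digraph n m) where
  open Digraph G

  data Reach : Fin n → Fin n → Set where
    here : ∀ {v} → Reach v v
    step : ∀ {v} (e : Fin m) → Reach (head e) v → Reach (tail e) v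

  NoLoops : Set
  NoLoops = ∀ (e : Fin m) → tail e ≢ head e

  StronglyConnected : Set
  StronglyConnected = ∀ (u v : Fin n) → Reach u v

-- A ribbon digraph: a strongly connected loopless digraph together with, at each
-- vertex, a cyclic ordering of its out-edges, given by the successor map e ↦ e⁺.
-- "Cyclic ordering" = next maps out-edges of v to out-edges of v and is a single
-- cycle on them: from any out-edge of v every out-edge of v is reached after a
-- positive number of steps.
record RibbonDigraph (n m : ℕ) : Set where
  field
    graph     : Digraph n m
    noLoops   : NoLoops graph
    strongly  : StronglyConnected graph
    next      : Fin m → Fin m
    next-tail : ∀ e → Digraph.tail graph (next e) ≡ Digraph.tail graph e
    cyclic    : ∀ e e' → Digraph.tail graph e ≡ Digraph.tail graph e' →
                ∃ λ k → iter next (suc k) e ≡ e'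
  open Digraph graph public

module _ {n m : ℕ} (G : RibbonDigraph n m) where
  open RibbonDigraph G

  Divisor : Set
  Divisor = Vec ℤ n

  RawRotor : Set
  RawRotor = Vec (Fin m) n

  IsRotor : RawRotor → Set
  IsRotor ρ = ∀ v → tail (lookup ρ v) ≡ v

  RawDRC : Set
  RawDRC = Divisor × RawRotor

  DRC : Set
  DRC = Σ RawDRC (λ c → IsRotor (Data.Product.proj₂ c))

  -- routing at v (unconstrained: no condition on x(v))
  route : Fin n → RawDRC → RawDRC
  route v (x , ρ) =
    let e⁺ = next (lookup ρ v)
    in ((x [ v ]%= (_- + 1)) [ head e⁺ ]%= (_+ + 1)) , (ρ [ v ]≔ e⁺)

  data RouteStep : RawDRC → RawDRC → Set where
    routeAt : ∀ (v : Fin n) (c : RawDRC) → RouteStep c (route v c)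

  _∼_ : DRC → DRC → Set
  c₁ ∼ c₂ = Star RouteStep (proj₁ c₁) (proj₁ c₂)

module Submission where

-- Reflexivity and transitivity of linear equivalence are those of the
-- reflexive-transitive closure Star; the content is symmetry, i.e. that one
-- routing can always be undone by further routings.  The argument:
--   (1) Routings at two vertices commute, and each routing is injective, so
--       running a list of routings depends on the list only up to permutation
--       and is an injective map of configurations.
--   (2) A single chip moved by routing (a rotor walk) lives on a finite state
--       space, so it becomes periodic; one period is a list ℓ of vertices with
--       run ℓ (x , τ) ≡ (x , τ) for one rotor configuration τ and all x.
--   (3) Every rotor configuration can be routed into τ, so by (1) the list ℓ
--       fixes every configuration: ℓ is a universal loop.
--   (4) A universal loop is closed under out-edges (an edge leaving it would
--       add chips at a vertex that never fires), so by strong connectivity it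
--       contains every vertex v; writing ℓ ↭ v ∷ ℓ′, the routings ℓ′ undo v.

open import Defs
open import Data.Nat using (ℕ)
open import Relation.Binary.Structures using (IsEquivalence)

import Data.Nat as Nat
open Nat using (zero; suc; _^_)
import Data.Nat.Properties as NatP
open import Data.Integer using (ℤ; _+_; -_; 0ℤ; 1ℤ; -1ℤ; _≤_; _<_)
import Data.Integer.Properties as ℤP
open import Algebra.Properties.AbelianGroup ℤP.+-0-abelianGroup using (//-rightDividesʳ)
open import Algebra.Properties.CommutativeSemigroup ℤP.+-commutativeSemigroup using (xy∙z≈xz∙y)
open import Data.Fin using (Fin; toℕ; combine; _≟_)
open import Data.Fin.Properties using (pigeonhole; combine-injective)
open import Data.Vec as Vec using (Vec; []; _∷_; lookup; updateAt; _[_]≔_; _[_]%=_)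
open import Data.Vec.Properties
  using (updateAt-updateAt; updateAt-cong; updateAt-id; updateAt-commutes; lookup∘updateAt;
         lookup∘updateAt′; lookup∘update; lookup∘update′; []≔-idempotent; []≔-commutes; []≔-lookup)
open import Data.Vec.Relation.Binary.Pointwise.Extensional using (ext; Pointwise-≡⇒≡)
open import Data.List using (List; []; _∷_; _++_; replicate; allFin)
open import Data.List.Relation.Unary.Any as Any using (here; there)
open import Data.List.Relation.Unary.All as All using (All; []; _∷_)
open import Data.List.Relation.Unary.All.Properties using (¬Any⇒All¬; ++⁻ˡ; ++⁻ʳ)
open import Data.List.Membership.Propositional using (_∈_)
open import Data.List.Membership.Propositional.Properties using (∈-allFin; ∈-∃++)
open import Data.List.Relation.Binary.Permutation.Propositional as Perm using (_↭_; ↭-sym)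
open import Data.List.Relation.Binary.Permutation.Propositional.Properties using (++-comm; shift)
open import Data.Product using (∃; ∃₂; _×_; _,_; proj₁; proj₂)
open import Data.Sum using (_⊎_; inj₁; inj₂)
open import Data.Empty using (⊥-elim)
open import Function using (_∘_)
open import Relation.Nullary using (yes; no)
open import Relation.Binary.PropositionalEquality
open import Relation.Binary.Construct.Closure.ReflexiveTransitive using (Star; ε; _◅_; _◅◅_)
open ≡-Reasoning

iter-shift : ∀ {A : Set} (f : A → A) k a → iter f k (f a) ≡ f (iter f k a)
iter-shift f zero    a = refl
iter-shift f (suc k) a = cong f (iter-shift f k a)

iter-+ : ∀ {A : Set} (f : A → A) j k a → iter f j (iter f k a) ≡ iter f (j Nat.+ k) a
iter-+ f zero    k a = refl
iter-+ f (suc j) k a = cong f (iter-+ f j k a)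

iter-period : ∀ {A : Set} (f : A → A) {a} j → iter f (suc j) a ≡ a →
              ∀ r → iter f (r Nat.* suc j) a ≡ a
iter-period f     j fix zero    = refl
iter-period f {a} j fix (suc r) = begin
  iter f (suc j Nat.+ r Nat.* suc j) a     ≡⟨ sym (iter-+ f (suc j) (r Nat.* suc j) a) ⟩
  iter f (suc j) (iter f (r Nat.* suc j) a) ≡⟨ cong (iter f (suc j)) (iter-period f j fix r) ⟩
  iter f (suc j) a                     ≡⟨ fix ⟩
  a                                    ∎

-- A map all of whose points are periodic is injective: a and b are both
-- recovered from f a ≡ f b by a common multiple of their periods.
periodic⇒injective : ∀ {A : Set} (f : A → A) → (∀ a → ∃ λ j → iter f (suc j) a ≡ a) →
                     ∀ {a b} → f a ≡ f b → a ≡ b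
periodic⇒injective f periodic {a} {b} fa≡fb with periodic a | periodic b
... | j , fixa | k , fixb = begin
  a                              ≡⟨ sym (iter-period f j fixa (suc k)) ⟩
  iter f (suc P) a               ≡⟨ sym (iter-shift f P a) ⟩
  iter f P (f a)                 ≡⟨ cong (iter f P) fa≡fb ⟩
  iter f P (f b)                 ≡⟨ iter-shift f P b ⟩
  iter f (suc k Nat.* suc j) b     ≡⟨ cong (λ t → iter f t b) (NatP.*-comm (suc k) (suc j)) ⟩
  iter f (suc j Nat.* suc k) b     ≡⟨ iter-period f k fixb (suc j) ⟩
  b                              ∎
  where P = j Nat.+ k Nat.* suc j

-- On a type coded injectively by a finite set, every orbit is eventually
-- periodic (pigeonhole principle on the first N + 1 iterates).
eventually-periodic : ∀ {A : Set} {N} (code : A → Fin N) → (∀ {a b} → code a ≡ code b → a ≡ b) →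
                      (f : A → A) (a : A) → ∃₂ λ i k → iter f (suc k) (iter f i a) ≡ iter f i a
eventually-periodic {N = N} code code-injective f a
  with pigeonhole (NatP.n<1+n N) (λ t → code (iter f (toℕ t) a))
... | s , t , s<t , same with NatP.m≤n⇒∃[o]m+o≡n s<t
...   | k , s+1+k≡t = toℕ s , k , (begin
  iter f (suc k) (iter f (toℕ s) a) ≡⟨ iter-+ f (suc k) (toℕ s) a ⟩
  iter f (suc k Nat.+ toℕ s) a        ≡⟨ cong (λ r → iter f (suc r) a) (NatP.+-comm k (toℕ s)) ⟩
  iter f (suc (toℕ s) Nat.+ k) a      ≡⟨ cong (λ r → iter f r a) s+1+k≡t ⟩
  iter f (toℕ t) a                  ≡⟨ sym (code-injective same) ⟩
  iter f (toℕ s) a                  ∎)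

encodeVec : ∀ {m k} → Vec (Fin m) k → Fin (m ^ k)
encodeVec []       = Fin.zero
encodeVec (a ∷ as) = combine a (encodeVec as)

encodeVec-injective : ∀ {m k} {as bs : Vec (Fin m) k} → encodeVec as ≡ encodeVec bs → as ≡ bs
encodeVec-injective {as = []}     {[]}     _  = refl
encodeVec-injective {as = a ∷ as} {b ∷ bs} eq
  with combine-injective a (encodeVec as) b (encodeVec bs) eq
... | refl , codes≡ = cong (a ∷_) (encodeVec-injective codes≡)

addAt : ∀ {n} → Fin n → ℤ → Vec ℤ n → Vec ℤ n
addAt i k x = x [ i ]%= (_+ k)

addAt-comm : ∀ {n} (i j : Fin n) k l x → addAt i k (addAt j l x) ≡ addAt j l (addAt i k x)
addAt-comm i j k l x with i ≟ j
... | no i≢j  = updateAt-commutes i j i≢j x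
... | yes refl = begin
  updateAt (updateAt x i (_+ l)) i (_+ k) ≡⟨ updateAt-updateAt i x ⟩
  updateAt x i ((_+ k) ∘ (_+ l))           ≡⟨ updateAt-cong i (λ a → xy∙z≈xz∙y a l k) x ⟩
  updateAt x i ((_+ l) ∘ (_+ k))           ≡⟨ sym (updateAt-updateAt i x) ⟩
  updateAt (updateAt x i (_+ k)) i (_+ l) ∎

addAt-cancel : ∀ {n} (i : Fin n) k x → addAt i (- k) (addAt i k x) ≡ x
addAt-cancel i k x = begin
  updateAt (updateAt x i (_+ k)) i (_+ - k) ≡⟨ updateAt-updateAt i x ⟩
  updateAt x i (λ a → (a + k) + - k)       ≡⟨ updateAt-cong i (//-rightDividesʳ k) x ⟩
  updateAt x i (λ a → a)                   ≡⟨ updateAt-id i x ⟩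
  x                                        ∎

addAt-injective : ∀ {n} (i : Fin n) k {x y} → addAt i k x ≡ addAt i k y → x ≡ y
addAt-injective i k {x} {y} eq = begin
  x                          ≡⟨ sym (addAt-cancel i k x) ⟩
  addAt i (- k) (addAt i k x) ≡⟨ cong (addAt i (- k)) eq ⟩
  addAt i (- k) (addAt i k y) ≡⟨ addAt-cancel i k y ⟩
  y                          ∎

<-+1 : ∀ i → i < i + 1ℤ
<-+1 i = ℤP.suc[i]≤j⇒i<j (ℤP.≤-reflexive (ℤP.+-comm 1ℤ i))

first-occurrence : ∀ {n} {u : Fin n} {ℓ} → u ∈ ℓ →
                   ∃₂ λ α β → ℓ ≡ α ++ u ∷ β × All (u ≢_) α
first-occurrence {u = u} {y ∷ ℓ} u∈ with u ≟ y
... | yes refl = [] , ℓ , refl , []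
... | no u≢y with first-occurrence (Any.tail u≢y u∈)
...   | α , β , refl , u∉α = y ∷ α , β , refl , u≢y ∷ u∉α

module Routing {n m : ℕ} (G : RibbonDigraph n m) where
  open RibbonDigraph G
  open import Data.List.Membership.DecPropositional (_≟_ {n}) using (_∈?_)

  Config : Set
  Config = RawDRC G

  Rotor : Set
  Rotor = RawRotor G

  Valid : Rotor → Set
  Valid = IsRotor G

  _⇝_ : Config → Config → Set
  _⇝_ = Star (RouteStep G)

  advance : Fin n → Rotor → Rotor
  advance u ρ = ρ [ u ]≔ next (lookup ρ u)

  target : Fin n → Rotor → Fin n
  target u ρ = head (next (lookup ρ u))

  fire : Fin n → Fin n → Vec ℤ n → Vec ℤ n
  fire u t x = addAt t 1ℤ (addAt u -1ℤ x)

  chips : Config → Fin n → ℤ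
  chips c w = lookup (proj₁ c) w

  -- (1) Routings commute and are injective

  fire-comm : ∀ u t w s x → fire u t (fire w s x) ≡ fire w s (fire u t x)
  fire-comm u t w s x = begin
    addAt t 1ℤ (addAt u -1ℤ (addAt s 1ℤ (addAt w -1ℤ x)))
      ≡⟨ cong (addAt t 1ℤ) (addAt-comm u s -1ℤ 1ℤ _) ⟩
    addAt t 1ℤ (addAt s 1ℤ (addAt u -1ℤ (addAt w -1ℤ x)))
      ≡⟨ cong (addAt t 1ℤ ∘ addAt s 1ℤ) (addAt-comm u w -1ℤ -1ℤ x) ⟩
    addAt t 1ℤ (addAt s 1ℤ (addAt w -1ℤ (addAt u -1ℤ x)))
      ≡⟨ addAt-comm t s 1ℤ 1ℤ _ ⟩
    addAt s 1ℤ (addAt t 1ℤ (addAt w -1ℤ (addAt u -1ℤ x)))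
      ≡⟨ cong (addAt s 1ℤ) (addAt-comm t w 1ℤ -1ℤ _) ⟩
    addAt s 1ℤ (addAt w -1ℤ (addAt t 1ℤ (addAt u -1ℤ x))) ∎

  lookup-advance : ∀ {u w} ρ → u ≢ w → lookup (advance w ρ) u ≡ lookup ρ u
  lookup-advance ρ u≢w = lookup∘update′ u≢w ρ _

  target-advance : ∀ {u w} ρ → u ≢ w → target u (advance w ρ) ≡ target u ρ
  target-advance ρ u≢w = cong (head ∘ next) (lookup-advance ρ u≢w)

  advance-comm : ∀ {u w} ρ → u ≢ w → advance u (advance w ρ) ≡ advance w (advance u ρ)
  advance-comm {u} {w} ρ u≢w = begin
    (ρ [ w ]≔ nw) [ u ]≔ next (lookup (advance w ρ) u)
      ≡⟨ cong (λ e → (ρ [ w ]≔ nw) [ u ]≔ next e) (lookup-advance ρ u≢w) ⟩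
    (ρ [ w ]≔ nw) [ u ]≔ nu
      ≡⟨ []≔-commutes ρ w u (u≢w ∘ sym) ⟩
    (ρ [ u ]≔ nu) [ w ]≔ nw
      ≡⟨ cong (λ e → (ρ [ u ]≔ nu) [ w ]≔ next e) (sym (lookup-advance ρ (u≢w ∘ sym))) ⟩
    advance w (advance u ρ) ∎
    where nu = next (lookup ρ u)
          nw = next (lookup ρ w)

  route-comm : ∀ u w c → route G u (route G w c) ≡ route G w (route G u c)
  route-comm u w (x , ρ) with u ≟ w
  ... | yes refl = refl
  ... | no u≢w   = cong₂ _,_ divisors (advance-comm ρ u≢w)
    where
    divisors : fire u (target u (advance w ρ)) (fire w (target w ρ) x)
             ≡ fire w (target w (advance u ρ)) (fire u (target u ρ) x)
    divisors = begin
      fire u (target u (advance w ρ)) (fire w (target w ρ) x)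
        ≡⟨ cong (λ t → fire u t (fire w (target w ρ) x)) (target-advance ρ u≢w) ⟩
      fire u (target u ρ) (fire w (target w ρ) x)
        ≡⟨ fire-comm u _ w _ x ⟩
      fire w (target w ρ) (fire u (target u ρ) x)
        ≡⟨ cong (λ t → fire w t (fire u (target u ρ) x)) (sym (target-advance ρ (u≢w ∘ sym))) ⟩
      fire w (target w (advance u ρ)) (fire u (target u ρ) x) ∎

  -- The successor map is a permutation of the edges, since each edge lies on a cycle.
  next-injective : ∀ {e e′} → next e ≡ next e′ → e ≡ e′
  next-injective = periodic⇒injective next (λ e → cyclic e e refl)

  restore-advance : ∀ u ρ → advance u ρ [ u ]≔ lookup ρ u ≡ ρ
  restore-advance u ρ = trans ([]≔-idempotent ρ u) ([]≔-lookup ρ u)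

  advance-injective : ∀ u {ρ ρ′} → advance u ρ ≡ advance u ρ′ → ρ ≡ ρ′
  advance-injective u {ρ} {ρ′} eq = begin
    ρ                                ≡⟨ sym (restore-advance u ρ) ⟩
    advance u ρ [ u ]≔ lookup ρ u    ≡⟨ cong₂ (λ r e → r [ u ]≔ e) eq (next-injective same-next) ⟩
    advance u ρ′ [ u ]≔ lookup ρ′ u  ≡⟨ restore-advance u ρ′ ⟩
    ρ′                               ∎
    where
    same-next : next (lookup ρ u) ≡ next (lookup ρ′ u)
    same-next = begin
      next (lookup ρ u)       ≡⟨ sym (lookup∘update u ρ _) ⟩
      lookup (advance u ρ) u  ≡⟨ cong (λ r → lookup r u) eq ⟩
      lookup (advance u ρ′) u ≡⟨ lookup∘update u ρ′ _ ⟩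
      next (lookup ρ′ u)      ∎

  route-injective : ∀ u {c c′} → route G u c ≡ route G u c′ → c ≡ c′
  route-injective u {x , ρ} {x′ , ρ′} eq with advance-injective u (cong proj₂ eq)
  ... | refl = cong (_, ρ) (addAt-injective u -1ℤ (addAt-injective (target u ρ) 1ℤ (cong proj₁ eq)))

  run : List (Fin n) → Config → Config
  run []      c = c
  run (u ∷ σ) c = run σ (route G u c)

  run-⇝ : ∀ σ c → c ⇝ run σ c
  run-⇝ []      c = ε
  run-⇝ (u ∷ σ) c = routeAt u c ◅ run-⇝ σ (route G u c)

  run-++ : ∀ σ τ c → run (σ ++ τ) c ≡ run τ (run σ c)
  run-++ []      τ c = refl
  run-++ (u ∷ σ) τ c = run-++ σ τ (route G u c)

  -- By commutation, a run only depends on the multiset of routed vertices.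
  run-↭ : ∀ {σ τ} → σ ↭ τ → ∀ c → run σ c ≡ run τ c
  run-↭ Perm.refl            c = refl
  run-↭ (Perm.prep u p)      c = run-↭ p (route G u c)
  run-↭ (Perm.swap {ys = τ} u w p) c =
    trans (run-↭ p (route G w (route G u c))) (cong (run τ) (route-comm w u c))
  run-↭ (Perm.trans p q)     c = trans (run-↭ p c) (run-↭ q c)

  run-injective : ∀ σ {c c′} → run σ c ≡ run σ c′ → c ≡ c′
  run-injective []      eq = eq
  run-injective (u ∷ σ) eq = route-injective u (run-injective σ eq)

  advanceAll : List (Fin n) → Rotor → Rotor
  advanceAll []      ρ = ρ
  advanceAll (u ∷ σ) ρ = advanceAll σ (advance u ρ)

  run-rotor : ∀ σ x ρ → proj₂ (run σ (x , ρ)) ≡ advanceAll σ ρ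
  run-rotor []      x ρ = refl
  run-rotor (u ∷ σ) x ρ = run-rotor σ _ (advance u ρ)

  advanceAll-++ : ∀ σ τ ρ → advanceAll (σ ++ τ) ρ ≡ advanceAll τ (advanceAll σ ρ)
  advanceAll-++ []      τ ρ = refl
  advanceAll-++ (u ∷ σ) τ ρ = advanceAll-++ σ τ (advance u ρ)

  advanceAll-avoiding : ∀ {u} σ ρ → All (u ≢_) σ → lookup (advanceAll σ ρ) u ≡ lookup ρ u
  advanceAll-avoiding []      ρ []            = refl
  advanceAll-avoiding (p ∷ σ) ρ (u≢p ∷ u∉σ) =
    trans (advanceAll-avoiding σ (advance p ρ) u∉σ) (lookup-advance ρ u≢p)

  set-valid : ∀ ρ {e u} → Valid ρ → tail e ≡ u → Valid (ρ [ u ]≔ e)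
  set-valid ρ {e} {u} valid tail≡ v with v ≟ u
  ... | yes refl = trans (cong tail (lookup∘update v ρ e)) tail≡
  ... | no v≢u   = trans (cong tail (lookup∘update′ v≢u ρ e)) (valid v)

  advance-valid : ∀ u ρ → Valid ρ → Valid (advance u ρ)
  advance-valid u ρ valid = set-valid ρ valid (trans (next-tail (lookup ρ u)) (valid u))

  advance-replicate : ∀ k u ρ → advanceAll (replicate k u) ρ ≡ ρ [ u ]≔ iter next k (lookup ρ u)
  advance-replicate zero    u ρ = sym ([]≔-lookup ρ u)
  advance-replicate (suc k) u ρ = begin
    advanceAll (replicate k u) (advance u ρ)
      ≡⟨ advance-replicate k u (advance u ρ) ⟩
    advance u ρ [ u ]≔ iter next k (lookup (advance u ρ) u)
      ≡⟨ cong (λ e → advance u ρ [ u ]≔ iter next k e) (lookup∘update u ρ _) ⟩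
    advance u ρ [ u ]≔ iter next k (next (lookup ρ u))
      ≡⟨ []≔-idempotent ρ u ⟩
    ρ [ u ]≔ iter next k (next (lookup ρ u))
      ≡⟨ cong (ρ [ u ]≔_) (iter-shift next k (lookup ρ u)) ⟩
    ρ [ u ]≔ iter next (suc k) (lookup ρ u) ∎

  -- By cyclicity, routing u often enough turns its rotor to any out-edge of u.
  turn-to : ∀ ρ {e u} → Valid ρ → tail e ≡ u → ∃ λ k → advanceAll (replicate k u) ρ ≡ ρ [ u ]≔ e
  turn-to ρ {e} {u} valid tail≡ with cyclic (lookup ρ u) e (trans (valid u) (sym tail≡))
  ... | k , reaches = suc k , trans (advance-replicate (suc k) u ρ) (cong (ρ [ u ]≔_) reaches)

  agree-update : ∀ (τ ρ : Rotor) u {vs} → (∀ w → w ∈ u ∷ vs ⊎ lookup ρ w ≡ lookup τ w) →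
                 ∀ w → w ∈ vs ⊎ lookup (ρ [ u ]≔ lookup τ u) w ≡ lookup τ w
  agree-update τ ρ u agree w with w ≟ u | agree w
  ... | yes refl | _               = inj₂ (lookup∘update w ρ (lookup τ w))
  ... | no w≢u   | inj₁ (here w≡u) = ⊥-elim (w≢u w≡u)
  ... | no w≢u   | inj₁ (there w∈) = inj₁ w∈
  ... | no w≢u   | inj₂ same       = inj₂ (trans (lookup∘update′ w≢u ρ (lookup τ u)) same)

  rotors-connected : ∀ (ρ τ : Rotor) → Valid ρ → Valid τ → ∃ λ σ → advanceAll σ ρ ≡ τ
  rotors-connected ρ τ valid validτ = align (allFin n) ρ valid (λ w → inj₁ (∈-allFin w))
    where
    align : ∀ vs (ρ : Rotor) → Valid ρ → (∀ w → w ∈ vs ⊎ lookup ρ w ≡ lookup τ w) → ∃ λ σ → advanceAll σ ρ ≡ τ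
    align [] ρ _ agree = [] , Pointwise-≡⇒≡ {xs = ρ} {ys = τ} (ext λ w → agreeing (agree w))
      where agreeing : ∀ {w} → w ∈ [] ⊎ lookup ρ w ≡ lookup τ w → lookup ρ w ≡ lookup τ w
            agreeing (inj₂ same) = same
    align (u ∷ vs) ρ valid agree with turn-to ρ valid (validτ u)
    ... | k , turned with align vs (ρ [ u ]≔ lookup τ u) (set-valid ρ valid (validτ u)) (agree-update τ ρ u agree)
    ...   | σ , done = replicate k u ++ σ , (begin
      advanceAll (replicate k u ++ σ) ρ          ≡⟨ advanceAll-++ (replicate k u) σ ρ ⟩
      advanceAll σ (advanceAll (replicate k u) ρ) ≡⟨ cong (advanceAll σ) turned ⟩
      advanceAll σ (ρ [ u ]≔ lookup τ u)          ≡⟨ done ⟩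
      τ                                          ∎)

  -- (2) The rotor walk of a single chip: its state is the chip's position and
  -- the rotors; trail k s lists the positions routed in k steps from s.
  Chip : Set
  Chip = Fin n × Rotor

  walk : Chip → Chip
  walk (p , ρ) = (target p ρ , advance p ρ)

  trail : ℕ → Chip → List (Fin n)
  trail zero    s       = []
  trail (suc k) (p , ρ) = p ∷ trail k (walk (p , ρ))

  carry : Vec ℤ n → Chip → Config
  carry x (p , ρ) = (addAt p 1ℤ x , ρ)

  run-trail : ∀ k s x → run (trail k s) (carry x s) ≡ carry x (iter walk k s)
  run-trail zero    s       x = refl
  run-trail (suc k) (p , ρ) x = begin
    run (trail k s′) (route G p (carry x (p , ρ)))
      ≡⟨ cong (λ z → run (trail k s′) (addAt (target p ρ) 1ℤ z , advance p ρ)) (addAt-cancel p 1ℤ x) ⟩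
    run (trail k s′) (carry x s′)  ≡⟨ run-trail k s′ x ⟩
    carry x (iter walk k s′)       ≡⟨ cong (carry x) (iter-shift walk k (p , ρ)) ⟩
    carry x (iter walk (suc k) (p , ρ)) ∎
    where s′ = walk (p , ρ)

  walk-valid : ∀ k s → Valid (proj₂ s) → Valid (proj₂ (iter walk k s))
  walk-valid zero    s valid = valid
  walk-valid (suc k) s valid = advance-valid (proj₁ (iter walk k s)) (proj₂ (iter walk k s)) (walk-valid k s valid)

  encodeChip : Chip → Fin (n Nat.* m ^ n)
  encodeChip (p , ρ) = combine p (encodeVec ρ)

  encodeChip-injective : ∀ {s t} → encodeChip s ≡ encodeChip t → s ≡ t
  encodeChip-injective {p , ρ} {q , τ} eq with combine-injective p (encodeVec ρ) q (encodeVec τ) eq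
  ... | refl , codes≡ = cong (p ,_) (encodeVec-injective codes≡)

  LoopAt : List (Fin n) → Rotor → Set
  LoopAt ℓ τ = ∀ x → run ℓ (x , τ) ≡ (x , τ)

  Universal : List (Fin n) → Set
  Universal ℓ = ∀ ρ → Valid ρ → LoopAt ℓ ρ

  -- (3) A loop at one valid rotor configuration is universal: route ρ to τ by
  -- σ; then σ ∘ ℓ = ℓ ∘ σ = σ on (x , ρ), and σ is injective.
  loop-universal : ∀ ℓ τ → Valid τ → LoopAt ℓ τ → Universal ℓ
  loop-universal ℓ τ validτ loop ρ valid x with rotors-connected ρ τ valid validτ
  ... | σ , σ-reaches = run-injective σ (begin
      run σ (run ℓ c)  ≡⟨ sym (run-++ ℓ σ c) ⟩
      run (ℓ ++ σ) c   ≡⟨ run-↭ (++-comm ℓ σ) c ⟩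
      run (σ ++ ℓ) c   ≡⟨ run-++ σ ℓ c ⟩
      run ℓ (run σ c)  ≡⟨ cong (run ℓ) at-τ ⟩
      run ℓ (y , τ)    ≡⟨ loop y ⟩
      (y , τ)          ≡⟨ sym at-τ ⟩
      run σ c          ∎)
    where
    c = (x , ρ)
    y = proj₁ (run σ c)
    at-τ : run σ c ≡ (y , τ)
    at-τ = cong (y ,_) (trans (run-rotor σ x ρ) σ-reaches)

  -- One period of an eventually periodic rotor walk is a nonempty universal loop.
  universal-loop : ∀ p ρ → Valid ρ → ∃ λ ℓ → Universal ℓ × ∃ (_∈ ℓ)
  universal-loop p ρ valid with eventually-periodic encodeChip encodeChip-injective walk (p , ρ)
  ... | i , k , period =
    ℓ , loop-universal ℓ (proj₂ s) (walk-valid i (p , ρ) valid) loop , proj₁ s , here refl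
    where
    s = iter walk i (p , ρ)
    ℓ = trail (suc k) s
    loop : LoopAt ℓ (proj₂ s)
    loop y = begin
      run ℓ (y , proj₂ s)                      ≡⟨ cong (λ z → run ℓ (z , proj₂ s)) (sym (addAt-cancel _ -1ℤ y)) ⟩
      run ℓ (carry y′ s)                       ≡⟨ run-trail (suc k) s y′ ⟩
      carry y′ (iter walk (suc k) s)           ≡⟨ cong (carry y′) period ⟩
      carry y′ s                               ≡⟨ cong (_, proj₂ s) (addAt-cancel _ -1ℤ y) ⟩
      (y , proj₂ s)                            ∎
      where y′ = addAt (proj₁ s) -1ℤ y

  -- (4) Universal loops are closed under out-edges

  route-mono : ∀ {w p} c → w ≢ p → chips c w ≤ chips (route G p c) w
  route-mono {w} {p} (x , ρ) w≢p with w ≟ target p ρ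
  ... | yes refl = ℤP.≤-trans (ℤP.i≤i+j (lookup x w) 1ℤ) (ℤP.≤-reflexive (sym gains))
    where
    gains : chips (route G p (x , ρ)) w ≡ lookup x w + 1ℤ
    gains = trans (lookup∘updateAt w (addAt p -1ℤ x)) (cong (_+ 1ℤ) (lookup∘updateAt′ w p w≢p x))
  ... | no w≢t = ℤP.≤-reflexive (sym (trans (lookup∘updateAt′ w (target p ρ) w≢t (addAt p -1ℤ x)) (lookup∘updateAt′ w p w≢p x)))

  run-mono : ∀ {w} σ c → All (w ≢_) σ → chips c w ≤ chips (run σ c) w
  run-mono []      c []            = ℤP.≤-refl
  run-mono (p ∷ σ) c (w≢p ∷ w∉σ) = ℤP.≤-trans (route-mono c w≢p) (run-mono σ (route G p c) w∉σ)

  route-adds : ∀ p x ρ → target p ρ ≢ p →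
               chips (route G p (x , ρ)) (target p ρ) ≡ lookup x (target p ρ) + 1ℤ
  route-adds p x ρ t≢p =
    trans (lookup∘updateAt (target p ρ) (addAt p -1ℤ x)) (cong (_+ 1ℤ) (lookup∘updateAt′ _ p t≢p x))

  escape-gains : ∀ e α β x ρ → next (lookup ρ (tail e)) ≡ e →
                 All (head e ≢_) (α ++ tail e ∷ β) → All (tail e ≢_) α →
                 lookup x (head e) < chips (run (α ++ tail e ∷ β) (x , ρ)) (head e)
  escape-gains e α β x ρ turns w∉ u∉α = begin-strict
    lookup x w                              ≤⟨ run-mono α (x , ρ) (++⁻ˡ α w∉) ⟩
    chips c₁ w                              <⟨ <-+1 (chips c₁ w) ⟩
    chips c₁ w + 1ℤ                         ≤⟨ ℤP.≤-reflexive (sym fires-at-w) ⟩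
    chips (route G u c₁) w                  ≤⟨ run-mono β (route G u c₁) (All.tail (++⁻ʳ α w∉)) ⟩
    chips (run β (route G u c₁)) w          ≤⟨ ℤP.≤-reflexive (cong (λ c → chips c w) (sym (run-++ α (u ∷ β) (x , ρ)))) ⟩
    chips (run (α ++ u ∷ β) (x , ρ)) w      ▯
    where
    open ℤP.≤-Reasoning using (begin-strict_; step-≤; step-<) renaming (_∎ to _▯)
    u = tail e
    w = head e
    c₁ = run α (x , ρ)
    aims-at-w : target u (proj₂ c₁) ≡ w
    aims-at-w = begin
      head (next (lookup (proj₂ c₁) u))       ≡⟨ cong (λ r → head (next (lookup r u))) (run-rotor α x ρ) ⟩
      head (next (lookup (advanceAll α ρ) u)) ≡⟨ cong (head ∘ next) (advanceAll-avoiding α ρ u∉α) ⟩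
      head (next (lookup ρ u))                ≡⟨ cong head turns ⟩
      w                                       ∎
    fires-at-w : chips (route G u c₁) w ≡ chips c₁ w + 1ℤ
    fires-at-w = subst (λ t → chips (route G u c₁) t ≡ chips c₁ t + 1ℤ) aims-at-w
                   (route-adds u (proj₁ c₁) (proj₂ c₁) (λ t≡u → noLoops e (sym (trans (sym aims-at-w) t≡u))))

  -- The head of every edge leaving a universal loop lies on it: otherwise set the
  -- rotor at its tail just before that edge and run the loop, gaining a chip.
  universal-closed : ∀ {ℓ} ρ → Valid ρ → Universal ℓ → ∀ e → tail e ∈ ℓ → head e ∈ ℓ
  universal-closed {ℓ} ρ valid universal e u∈ℓ with head e ∈? ℓ
  ... | yes w∈ℓ = w∈ℓ
  ... | no  w∉ℓ with cyclic e e refl | first-occurrence u∈ℓ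
  ...   | j , returns | α , β , refl , u∉α =
    ⊥-elim (ℤP.<-irrefl (cong (λ c → chips c (head e)) (sym fixed))
      (escape-gains e α β x ρ′ (trans (cong next (lookup∘update (tail e) ρ _)) returns) (¬Any⇒All¬ _ w∉ℓ) u∉α))
    where
    x = Vec.replicate n 0ℤ
    ρ′ = ρ [ tail e ]≔ iter next j e
    fixed : run (α ++ tail e ∷ β) (x , ρ′) ≡ (x , ρ′)
    fixed = universal ρ′ (set-valid ρ valid (iter-tail j)) x
      where
      iter-tail : ∀ k → tail (iter next k e) ≡ tail e
      iter-tail zero    = refl
      iter-tail (suc k) = trans (next-tail _) (iter-tail k)

  -- By strong connectivity a universal loop through one vertex passes through all.
  universal-spans : ∀ {ℓ u} ρ → Valid ρ → Universal ℓ → u ∈ ℓ → ∀ v → v ∈ ℓ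
  universal-spans {ℓ} {u} ρ valid universal u∈ℓ v = along (strongly u v) u∈ℓ
    where
    along : ∀ {a b} → Reach graph a b → a ∈ ℓ → b ∈ ℓ
    along here         a∈ℓ = a∈ℓ
    along (step e path) a∈ℓ = along path (universal-closed ρ valid universal e a∈ℓ)

  -- A routing at v is undone by the rest of a universal loop through v.
  route-undoable : ∀ v x ρ → Valid ρ → route G v (x , ρ) ⇝ (x , ρ)
  route-undoable v x ρ valid with universal-loop v ρ valid
  ... | ℓ , universal , u , u∈ℓ with ∈-∃++ (universal-spans ρ valid universal u∈ℓ v)
  ...   | α , β , refl = subst (route G v (x , ρ) ⇝_) undone (run-⇝ (α ++ β) (route G v (x , ρ)))
    where
    undone : run (v ∷ α ++ β) (x , ρ) ≡ (x , ρ)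
    undone = trans (run-↭ (↭-sym (shift v α β)) (x , ρ)) (universal ρ valid x)

  ⇝-sym : ∀ {c c′} → Valid (proj₂ c) → c ⇝ c′ → c′ ⇝ c
  ⇝-sym valid ε = ε
  ⇝-sym {x , ρ} valid (routeAt v _ ◅ steps) = ⇝-sym (advance-valid v ρ valid) steps ◅◅ route-undoable v x ρ valid

proposition3p4 : ∀ {n m : ℕ} (G : RibbonDigraph n m) → IsEquivalence (_∼_ G)
proposition3p4 G = record
  { refl  = ε
  ; sym   = λ {c₁} → Routing.⇝-sym G (proj₂ c₁)
  ; trans = _◅◅_
  }
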